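{- Let $k\ge3$ and $0<\alpha<1$. Suppose $G$ is an $r$-regular $k$-partite $k$-graph with vertex partition $\mathcal Z$ in which each part has order $n\ge3$. If $G$ satisfies $\mathrm{Exp}_1(\alpha)$, then $r\le\sqrt{2n}$.
   Context: A $k$-graph is a hypergraph each of whose edges has exactly $k$ vertices; $k$-partite means the vertex set is partitioned into $k$ classes with every edge containing exactly one vertex of each class; $r$-regular means every vertex lies in exactly $r$ edges. For $S\subseteq V(G)$, $N(S):=\big(\bigcup_{e\in E(G),\,e\cap S\ne\emptyset}e\big)\setminus S$. Property $\mathrm{Exp}_1(\alpha)$: for every $Z\in\mathcal Z$ and every $S\subset Z$ with $|S|\le r$, $|N(S)|\ge(k-1-\alpha)r|S|$.
   Formalization: The parameter α in Exp₁(α) is rational, still with $0<\alpha<1$. -}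

module Defs where

open import Data.Nat using (ℕ; _+_; _*_; _≤_; _<_)
open import Data.Bool using (Bool; true; false; _∧_; not; T)
open import Data.Bool.Properties using (T?)
open import Data.Fin using (Fin)
open import Data.Fin.Subset using (Subset; ∣_∣)
open import Data.Fin.Properties using () renaming (_≟_ to _≟ᶠ_)
open import Data.Vec using (Vec; lookup)
open import Data.List using (List; length; filter; allFin; cartesianProduct; map)
open import Data.Bool.ListAction using (any)
open import Data.List.Relation.Unary.Unique.Propositional using (Unique)
open import Data.Product using (_×_; _,_)
open import Relation.Nullary.Decidable using (does)
open import Relation.Binary.PropositionalEquality using (_≡_)

-- A k-partite k-graph whose k vertex classes Z_0,...,Z_{k-1} each have n
-- vertices.  Vertex (i , v) is the v-th vertex of class Z_i.  Since each edge
-- has exactly one vertex in each class, an edge is a vector e : Vec (Fin n) k,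
-- standing for the vertex set { (i , lookup e i) | i : Fin k }.
Vertex : ℕ → ℕ → Set
Vertex k n = Fin k × Fin n

Edge : ℕ → ℕ → Set
Edge k n = Vec (Fin n) k

record PartiteGraph (k n : ℕ) : Set where
  field
    edges  : List (Edge k n)
    unique : Unique edges
open PartiteGraph public

allVertices : (k n : ℕ) → List (Vertex k n)
allVertices k n = cartesianProduct (allFin k) (allFin n)

VSet : ℕ → ℕ → Set
VSet k n = Vertex k n → Bool

card : ∀ {k n} → VSet k n → ℕ
card {k} {n} P = length (filter (λ v → T? (P v)) (allVertices k n))

_∈ᵉ_ : ∀ {k n} → Vertex k n → Edge k n → Bool
(i , v) ∈ᵉ e = does (lookup e i ≟ᶠ v)

edgeVertices : ∀ {k n} → Edge k n → List (Vertex k n)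
edgeVertices {k} e = map (λ i → (i , lookup e i)) (allFin k)

degree : ∀ {k n} → PartiteGraph k n → Vertex k n → ℕ
degree G v = length (filter (λ e → T? (v ∈ᵉ e)) (edges G))

Regular : ∀ {k n} → PartiteGraph k n → ℕ → Set
Regular {k} {n} G r = ∀ (v : Vertex k n) → degree G v ≡ r

N : ∀ {k n} → PartiteGraph k n → VSet k n → VSet k n
N G S v = not (S v) ∧ any (λ e → any S (edgeVertices e) ∧ (v ∈ᵉ e)) (edges G)

inClass : ∀ {k n} → Fin k → Subset n → VSet k n
inClass i S (j , v) = does (j ≟ᶠ i) ∧ lookup S v

-- Exp_1(α) with α = p / q (q > 0):  for every class Z_i and every proper subset
-- S ⊊ Z_i with |S| ≤ r,  |N(S)| ≥ (k - 1 - p/q) r |S|,  written multiplied out by q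
-- in ℕ as  q·|N(S)| + p·r·|S| ≥ (k-1)·q·r·|S|.
Exp₁ : ∀ {k n} → PartiteGraph k n → (r p q : ℕ) → Set
Exp₁ {k} {n} G r p q =
  ∀ (i : Fin k) (S : Subset n) → ∣ S ∣ < n → ∣ S ∣ ≤ r →
    (k Data.Nat.∸ 1) * q * r * ∣ S ∣ ≤ q * card (N G (inClass i S)) + p * r * ∣ S ∣

{-# OPTIONS --safe #-}
-- A set S of s vertices inside one class Z_i has its neighbourhood in the other k − 1 classes, so
-- |N(S)| ≤ (k − 1)n, while Exp₁(α) with α < 1 gives |N(S)| > (k − 2)rs.  Since k ≥ 3 this forces
-- rs < 2n for every 0 < s < n with s ≤ r.  Taking s = n − 1 rules out r ≥ n (then rs ≥ 2n), and
-- then s = r gives r² < 2n.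
module Submission where

open import Defs
open import Data.Nat using (ℕ; zero; suc; _+_; _*_; _≤_; _<_; z≤n; s≤s; z<s; >-nonZero)
open import Data.Nat.Properties
open import Data.Nat.Tactic.RingSolver using (solve-∀)
open import Data.Bool using (T)
open import Data.Bool.Properties using (T?; T-∧; T-not-≡)
open import Data.Bool.ListAction using (any)
open import Data.Fin using (Fin) renaming (zero to 0F)
open import Data.Fin.Subset using (Subset; ∣_∣; inside; ⊥)
open import Data.Fin.Subset.Properties using (∣⊥∣≡0)
open import Data.Fin.Properties using () renaming (_≟_ to _≟ᶠ_)
open import Data.Vec using (lookup; _∷_)
open import Data.List using (List; length; filter; allFin; cartesianProduct; map; _++_; []; _∷_)
open import Data.List.Properties using (length-filter; filter-none; filter-++; length-++; length-map; length-tabulate)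
open import Data.List.Membership.Propositional using (_∈_)
open import Data.List.Membership.Propositional.Properties using (∈-allFin)
open import Data.List.Relation.Unary.Any using (here; there; satisfied)
open import Data.List.Relation.Unary.Any.Properties using (any⁻) renaming (map⁻ to Any-map⁻)
open import Data.List.Relation.Unary.All using (universal)
open import Data.List.Relation.Unary.All.Properties using () renaming (map⁺ to All-map⁺)
open import Data.Product using (_×_; _,_; ∃)
open import Function using (_∘_; Equivalence)
open import Relation.Nullary using (¬_; Dec; yes; no; does)
open import Relation.Unary using (Pred; Decidable)
open import Relation.Binary.PropositionalEquality using (_≡_; refl; cong; subst; subst₂)

module _ {a b p} {A : Set a} {B : Set b} {P : Pred (A × B) p} (P? : Decidable P) where
  open ≤-Reasoning

  private
    length-filter-row : ∀ x (ys : List B) → length (filter P? (map (x ,_) ys)) ≤ length ys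
    length-filter-row x ys = ≤-trans (length-filter P? (map (x ,_) ys)) (≤-reflexive (length-map (x ,_) ys))

    length-filter-cartesianProduct-∷ : ∀ x xs (ys : List B) →
      length (filter P? (cartesianProduct (x ∷ xs) ys))
        ≡ length (filter P? (map (x ,_) ys)) + length (filter P? (cartesianProduct xs ys))
    length-filter-cartesianProduct-∷ x xs ys = begin-equality
      length (filter P? (map (x ,_) ys ++ cartesianProduct xs ys))
        ≡⟨ cong length (filter-++ P? (map (x ,_) ys) (cartesianProduct xs ys)) ⟩
      length (filter P? (map (x ,_) ys) ++ filter P? (cartesianProduct xs ys))
        ≡⟨ length-++ (filter P? (map (x ,_) ys)) ⟩
      length (filter P? (map (x ,_) ys)) + length (filter P? (cartesianProduct xs ys)) ∎

  length-filter-cartesianProduct : ∀ (xs : List A) (ys : List B) →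
    length (filter P? (cartesianProduct xs ys)) ≤ length xs * length ys
  length-filter-cartesianProduct []       ys = z≤n
  length-filter-cartesianProduct (x ∷ xs) ys = begin
    length (filter P? (cartesianProduct (x ∷ xs) ys))
      ≡⟨ length-filter-cartesianProduct-∷ x xs ys ⟩
    length (filter P? (map (x ,_) ys)) + length (filter P? (cartesianProduct xs ys))
      ≤⟨ +-mono-≤ (length-filter-row x ys) (length-filter-cartesianProduct xs ys) ⟩
    length ys + length xs * length ys ∎

  length-filter-cartesianProduct-missingRow : ∀ {x} (xs : List A) (ys : List B) → x ∈ xs →
    (∀ y → ¬ P (x , y)) → length (filter P? (cartesianProduct xs ys)) + length ys ≤ length xs * length ys
  length-filter-cartesianProduct-missingRow (x ∷ xs) ys (here refl) ¬P = begin
    length (filter P? (cartesianProduct (x ∷ xs) ys)) + length ys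
      ≡⟨ cong (_+ length ys) (length-filter-cartesianProduct-∷ x xs ys) ⟩
    length (filter P? (map (x ,_) ys)) + length (filter P? (cartesianProduct xs ys)) + length ys
      ≡⟨ cong (λ m → length m + length (filter P? (cartesianProduct xs ys)) + length ys) row-empty ⟩
    length (filter P? (cartesianProduct xs ys)) + length ys
      ≡⟨ +-comm _ (length ys) ⟩
    length ys + length (filter P? (cartesianProduct xs ys))
      ≤⟨ +-monoʳ-≤ (length ys) (length-filter-cartesianProduct xs ys) ⟩
    length ys + length xs * length ys ∎
    where
    row-empty : filter P? (map (x ,_) ys) ≡ []
    row-empty = filter-none P? (All-map⁺ (universal ¬P ys))
  length-filter-cartesianProduct-missingRow (x′ ∷ xs) ys (there x∈xs) ¬P = begin
    length (filter P? (cartesianProduct (x′ ∷ xs) ys)) + length ys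
      ≡⟨ cong (_+ length ys) (length-filter-cartesianProduct-∷ x′ xs ys) ⟩
    length (filter P? (map (x′ ,_) ys)) + length (filter P? (cartesianProduct xs ys)) + length ys
      ≡⟨ +-assoc (length (filter P? (map (x′ ,_) ys))) _ _ ⟩
    length (filter P? (map (x′ ,_) ys)) + (length (filter P? (cartesianProduct xs ys)) + length ys)
      ≤⟨ +-mono-≤ (length-filter-row x′ ys) (length-filter-cartesianProduct-missingRow xs ys x∈xs ¬P) ⟩
    length ys + length xs * length ys ∎

card-missingClass : ∀ {k n} (P : VSet (suc k) n) (i : Fin (suc k)) → (∀ v → ¬ T (P (i , v))) →
  card P ≤ k * n
card-missingClass {k} {n} P i ¬P = +-cancelˡ-≤ n (card P) (k * n) (begin
  n + card P  ≡⟨ +-comm n (card P) ⟩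
  card P + n  ≤⟨ subst₂ (λ k′ n′ → card P + n′ ≤ k′ * n′) (length-allFin (suc k)) (length-allFin n)
                  (length-filter-cartesianProduct-missingRow (T? ∘ P) (allFin (suc k)) (allFin n) (∈-allFin i) ¬P) ⟩
  suc k * n   ∎)
  where
  open ≤-Reasoning
  length-allFin : ∀ m → length (allFin m) ≡ m
  length-allFin m = length-tabulate {n = m} (λ j → j)

T-does⁻ : ∀ {a} {A : Set a} (a? : Dec A) → T (does a?) → A
T-does⁻ (yes a) _  = a
T-does⁻ (no _)  ()

T-does⁺ : ∀ {a} {A : Set a} (a? : Dec A) → A → T (does a?)
T-does⁺ (yes _) _ = _
T-does⁺ (no ¬a) a = ¬a a

edge-meeting-inClass : ∀ {k n} (e : Edge k n) (i : Fin k) (S : Subset n) →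
  T (any (inClass i S) (edgeVertices e)) → T (lookup S (lookup e i))
edge-meeting-inClass e i S meets with satisfied (Any-map⁻ (any⁻ (inClass i S) (edgeVertices e) meets))
... | j , j∈S with Equivalence.to T-∧ j∈S
... | j≡i , ej∈S = subst (λ j′ → T (lookup S (lookup e j′))) (T-does⁻ (j ≟ᶠ i) j≡i) ej∈S

N-inClass-missingClass : ∀ {k n} (G : PartiteGraph k n) (i : Fin k) (S : Subset n) v →
  ¬ T (N G (inClass i S) (i , v))
N-inClass-missingClass G i S v inN with Equivalence.to T-∧ inN
... | v∉S , meeting with satisfied (any⁻ _ (edges G) meeting)
... | e , e-meets-∋v with Equivalence.to T-∧ e-meets-∋v
... | meets , ∋v = subst T (Equivalence.to T-not-≡ v∉S) v∈inClass
  where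
  v∈inClass : T (inClass i S (i , v))
  v∈inClass = Equivalence.from T-∧
    (T-does⁺ (i ≟ᶠ i) refl , subst (T ∘ lookup S) (T-does⁻ (lookup e i ≟ᶠ v) ∋v) (edge-meeting-inClass e i S meets))

subset-of-size : ∀ {m n} → m ≤ n → ∃ λ (S : Subset n) → ∣ S ∣ ≡ m
subset-of-size {n = n} z≤n = ⊥ , ∣⊥∣≡0 n
subset-of-size (s≤s m≤n) with subset-of-size m≤n
... | S , ∣S∣≡m = inside ∷ S , cong suc ∣S∣≡m

scaled-≤⇒< : ∀ {K N p q t} → p < q → 0 < t → suc K * q * t ≤ q * N + p * t → K * t < N
scaled-≤⇒< {K} {N} {p} {q} {t} p<q t>0 scaled-≤ =
  *-cancelˡ-< q (K * t) N (+-cancelʳ-< (q * t) (q * (K * t)) (q * N) (begin-strict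
    q * (K * t) + q * t  ≡⟨ regroup K q t ⟩
    suc K * q * t        ≤⟨ scaled-≤ ⟩
    q * N + p * t        <⟨ +-monoʳ-< (q * N) (*-monoˡ-< t {{>-nonZero t>0}} p<q) ⟩
    q * N + q * t        ∎))
  where
  open ≤-Reasoning
  regroup : ∀ K q t → q * (K * t) + q * t ≡ suc K * q * t
  regroup = solve-∀

exp₁⇒large-neighbourhood : ∀ {K n r p q} (G : PartiteGraph (2 + K) n) → Exp₁ G r p q → p < q →
  ∀ i S → 0 < ∣ S ∣ → ∣ S ∣ < n → ∣ S ∣ ≤ r → K * (r * ∣ S ∣) < card (N G (inClass i S))
exp₁⇒large-neighbourhood {K} {r = r} {p} {q} G exp p<q i S S>0 S<n S≤r =
  scaled-≤⇒< {K} p<q (*-mono-≤ (<-≤-trans S>0 S≤r) S>0)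
    (subst₂ _≤_ (*-assoc (suc K * q) r ∣ S ∣) (cong (q * card (N G (inClass i S)) +_) (*-assoc p r ∣ S ∣))
      (exp i S S<n S≤r))

exp₁⇒product-bound : ∀ {K n r p q} (G : PartiteGraph (2 + K) n) → 1 ≤ K → Exp₁ G r p q → p < q →
  ∀ {s} → 0 < s → s < n → s ≤ r → r * s < 2 * n
exp₁⇒product-bound {K} {n} {r} G K≥1 exp p<q s>0 s<n s≤r with subset-of-size (<⇒≤ s<n)
... | S , refl = *-cancelˡ-< K (r * ∣ S ∣) (2 * n) (begin-strict
  K * (r * ∣ S ∣)            <⟨ exp₁⇒large-neighbourhood G exp p<q 0F S s>0 s<n s≤r ⟩
  card (N G (inClass 0F S))  ≤⟨ card-missingClass _ 0F (N-inClass-missingClass G 0F S) ⟩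
  suc K * n                  ≤⟨ +-monoˡ-≤ (K * n) (m≤n*m n K {{>-nonZero K≥1}}) ⟩
  K * n + K * n              ≡⟨ double K n ⟩
  K * (2 * n)                ∎)
  where
  open ≤-Reasoning
  double : ∀ K n → K * n + K * n ≡ K * (2 * n)
  double = solve-∀

exp₁⇒degree<classSize : ∀ {K m r p q} (G : PartiteGraph (2 + K) (suc m)) → 1 ≤ K → Exp₁ G r p q →
  p < q → 2 ≤ m → r < suc m
exp₁⇒degree<classSize {m = m} {r} G K≥1 exp p<q 2≤m = ≰⇒> λ n≤r →
  ≤⇒≯ (subst (_≤ r * m) (*-comm (suc m) 2) (*-mono-≤ n≤r 2≤m))
      (exp₁⇒product-bound G K≥1 exp p<q (<-≤-trans z<s 2≤m) (n<1+n m) (≤-trans (n≤1+n m) n≤r))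

lemma3p1 : (k n r p q : ℕ) → 3 ≤ k → 3 ≤ n → 0 < p → p < q →
    (G : PartiteGraph k n) → Regular G r → Exp₁ G r p q →
    r * r ≤ 2 * n
lemma3p1 _ _ zero _ _ _ _ _ _ _ _ _ = z≤n
lemma3p1 (suc (suc K)) (suc m) (suc r) p q (s≤s (s≤s K≥1)) (s≤s 2≤m) _ p<q G _ exp =
  <⇒≤ (exp₁⇒product-bound G K≥1 exp p<q z<s (exp₁⇒degree<classSize G K≥1 exp p<q 2≤m) ≤-refl)
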